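{- Let $C=(T,\beta)$ be a cyclic tree, $B\subseteq\mathrm{dom}(\beta)$, and let $\eta,\eta'$ be $B$-maximal strongly connected subsets of $B$. Then either $\eta=\eta'$ or $\eta\cap\eta'=\emptyset$.
   Context: A tree is a non-empty prefix-closed set $T\subseteq\omega^*$ (root $\varepsilon$; $s<t$ means $s$ is a strict prefix of $t$; children of $t$ are the $t\cdot i\in T$). A cyclic tree is a pair $C=(T,\beta)$ with $T$ finite and $\beta$ a partial map from leaves of $T$ to inner nodes of $T$; elements of $\mathrm{dom}(\beta)$ are buds. Standing assumption: cycle normal form, i.e. $\beta(t)<t$ for all buds $t$. The local cycle of a bud $t$ is $\gamma(t):=[\beta(t),t]=\{u\mid\beta(t)\le u\le t\}$. For $\eta\subseteq\mathrm{dom}(\beta)$, $C[\eta]:=\bigcup_{s\in\eta}\gamma(s)$. A finite path is a non-empty sequence of nodes where each next node is a child of the current one, or, if the current one is a bud, its companion. $\eta$ is strongly connected if there is a finite path starting and ending at the same node that visits exactly the nodes of $C[\eta]$. For $B\subseteq\mathrm{dom}(\beta)$, a strongly connected $\eta$ is $B$-maximal if $\eta\subseteq B$ and there is no strongly connected $\eta'$ with $\eta\subsetneq\eta'\subseteq B$. -}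

module Defs where

open import Data.Nat using (ℕ)
open import Data.List using (List; []; _∷_; _++_; [_]; last)
open import Data.List.Membership.Propositional using (_∈_; _∉_)
open import Data.List.Relation.Unary.All using (All)
open import Data.Maybe using (Maybe; just)
open import Data.Product using (Σ; ∃; ∃-syntax; _×_; _,_)
open import Data.Sum using (_⊎_)
open import Data.Empty using (⊥)
open import Data.Unit using (⊤)
open import Relation.Nullary using (¬_)
open import Relation.Binary.PropositionalEquality using (_≡_; _≢_)

Node : Set
Node = List ℕ

_≼_ : Node → Node → Set
u ≼ t = ∃[ w ] (u ++ w ≡ t)

_≺_ : Node → Node → Set
u ≺ t = (u ≼ t) × (u ≢ t)

NodeSet : Set
NodeSet = List Node

IsLeaf : NodeSet → Node → Set
IsLeaf T t = (t ∈ T) × (∀ (i : ℕ) → (t ++ [ i ]) ∉ T)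

IsInner : NodeSet → Node → Set
IsInner T t = (t ∈ T) × (∃[ i ] ((t ++ [ i ]) ∈ T))

record CyclicTree : Set where
  field
    T          : NodeSet
    root∈      : [] ∈ T                                  -- non-empty (given prefix-closure)
    prefClosed : ∀ {u t} → t ∈ T → u ≼ t → u ∈ T
    β          : Node → Maybe Node
    β-leaf     : ∀ {t u} → β t ≡ just u → IsLeaf T t
    β-inner    : ∀ {t u} → β t ≡ just u → IsInner T u
    β-normal   : ∀ {t u} → β t ≡ just u → u ≺ t

_⊆ₛ_ : NodeSet → NodeSet → Set
η ⊆ₛ η' = ∀ {s} → s ∈ η → s ∈ η'

module _ (C : CyclicTree) where
  open CyclicTree C

  IsBud : Node → Set
  IsBud t = ∃[ u ] (β t ≡ just u)

  InLocalCycle : Node → Node → Set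
  InLocalCycle s u = ∃[ b ] ((β s ≡ just b) × (b ≼ u) × (u ≼ s))

  InC[_] : NodeSet → Node → Set
  InC[ η ] u = ∃[ s ] ((s ∈ η) × InLocalCycle s u)

  Step : Node → Node → Set
  Step u v = (∃[ i ] ((v ≡ u ++ [ i ]) × (v ∈ T))) ⊎ (β u ≡ just v)

  StepsFrom : Node → List Node → Set
  StepsFrom x [] = ⊤
  StepsFrom x (y ∷ ys) = Step x y × StepsFrom y ys

  IsPath : Node → List Node → Set
  IsPath x xs = (x ∈ T) × StepsFrom x xs

  StronglyConnected : NodeSet → Set
  StronglyConnected η =
    All IsBud η ×
    (∃[ x ] ∃[ xs ] (IsPath x xs × (last (x ∷ xs) ≡ just x)
        × (∀ u → (u ∈ (x ∷ xs) → InC[ η ] u) × (InC[ η ] u → u ∈ (x ∷ xs)))))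

  _⊂ₛ_ : NodeSet → NodeSet → Set
  η ⊂ₛ η' = (η ⊆ₛ η') × ¬ (η' ⊆ₛ η)

  BMaximal : NodeSet → NodeSet → Set
  BMaximal B η = StronglyConnected η × (η ⊆ₛ B)
    × (∀ η' → StronglyConnected η' → η ⊂ₛ η' → η' ⊆ₛ B → ⊥)

-- If η and η' share a bud s, then s lies on both closed paths witnessing
-- strong connectivity. Rotating each of them to start at s and concatenating
-- gives a closed path visiting exactly C[η ∪ η'], so η ∪ η' is strongly
-- connected; it lies in B, hence by maximality η = η ∪ η' = η'.
module Submission where

open import Defs
open import Data.List.Relation.Unary.All using (All)
open import Data.List.Membership.Propositional using (_∈_)
open import Data.Product using (_×_)
open import Data.Sum using (_⊎_)
open import Data.Empty using (⊥)

open import Function using (_∘_)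
open import Data.Nat using (_≟_)
open import Data.List using (List; []; _∷_; _++_; last)
open import Data.List.Properties using (≡-dec; ++-identityʳ)
open import Data.List.Relation.Unary.Any using (here; there; any?)
import Data.List.Relation.Unary.All as All
import Data.List.Relation.Unary.All.Properties as All
open import Data.List.Membership.Propositional using (find; lose)
open import Data.List.Membership.Propositional.Properties using (∈-++⁺ˡ; ∈-++⁺ʳ; ∈-++⁻)
open import Data.List.Membership.DecPropositional (≡-dec _≟_) using (_∈?_)
open import Data.List.Relation.Binary.Subset.Propositional.Properties using (xs⊆xs++ys)
open import Data.Maybe using (just)
open import Data.Maybe.Properties using (just-injective)
open import Data.Product using (∃-syntax; _,_; proj₁; proj₂)
open import Data.Sum using (inj₁; inj₂; [_,_]′)
open import Data.Empty using (⊥-elim)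
open import Data.Unit using (tt)
open import Relation.Nullary using (yes; no)
open import Relation.Binary.PropositionalEquality using (_≡_; refl; sym; trans)

private
  variable
    s u x : Node
    p q xs ys : List Node
    B η η' : NodeSet

last-∈ : last (x ∷ xs) ≡ just s → s ∈ x ∷ xs
last-∈ {xs = []}     eq = here (sym (just-injective eq))
last-∈ {xs = _ ∷ xs} eq = there (last-∈ eq)

last-++ : ∀ p q → last (x ∷ p) ≡ just s → last (x ∷ p ++ q) ≡ last (s ∷ q)
last-++ []      q eq rewrite just-injective eq = refl
last-++ (_ ∷ p) q eq = last-++ p q eq

∈-rotate : ∀ p q → last (s ∷ q) ≡ just x → u ∈ x ∷ p ++ q → u ∈ s ∷ q ++ p
∈-rotate p q last-q (here refl) = ∈-++⁺ˡ {xs = _ ∷ q} (last-∈ last-q)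
∈-rotate p q _ (there u∈p++q) with ∈-++⁻ p u∈p++q
... | inj₁ u∈p = there (∈-++⁺ʳ q u∈p)
... | inj₂ u∈q = there (∈-++⁺ˡ u∈q)

∈-∷-++⁺ʳ : u ∈ s ∷ ys → u ∈ s ∷ xs ++ ys
∈-∷-++⁺ʳ (here refl)  = here refl
∈-∷-++⁺ʳ {xs = xs} (there u∈ys) = there (∈-++⁺ʳ xs u∈ys)

++-⊆ : η ⊆ₛ B → η' ⊆ₛ B → (η ++ η') ⊆ₛ B
++-⊆ {η} η⊆B η'⊆B = [ η⊆B , η'⊆B ]′ ∘ ∈-++⁻ η

module _ (C : CyclicTree) where
  open CyclicTree C

  ClosedWalk : Node → List Node → Set
  ClosedWalk x xs = StepsFrom C x xs × last (x ∷ xs) ≡ just x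

  VisitsExactly : NodeSet → Node → List Node → Set
  VisitsExactly η x xs = ∀ u → (u ∈ x ∷ xs → InC[_] C η u) × (InC[_] C η u → u ∈ x ∷ xs)

  StepsFrom-++ : StepsFrom C x p → last (x ∷ p) ≡ just s → StepsFrom C s q →
                 StepsFrom C x (p ++ q)
  StepsFrom-++ {p = []}    _              eq steps-q rewrite just-injective eq = steps-q
  StepsFrom-++ {p = _ ∷ _} (step , steps) eq steps-q = step , StepsFrom-++ steps eq steps-q

  StepsFrom-split : StepsFrom C x xs → s ∈ x ∷ xs →
    ∃[ p ] ∃[ q ] (xs ≡ p ++ q × StepsFrom C x p × last (x ∷ p) ≡ just s × StepsFrom C s q)
  StepsFrom-split steps (here refl) = [] , _ , refl , tt , refl , steps
  StepsFrom-split {xs = y ∷ _} (step , steps) (there s∈) with StepsFrom-split steps s∈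
  ... | p , q , refl , steps-p , last-p , steps-q = y ∷ p , q , refl , (step , steps-p) , last-p , steps-q

  closedWalk-rotate : ClosedWalk x xs → s ∈ x ∷ xs →
    ∃[ ys ] (ClosedWalk s ys × (∀ u → u ∈ x ∷ xs → u ∈ s ∷ ys) × (∀ u → u ∈ s ∷ ys → u ∈ x ∷ xs))
  closedWalk-rotate (steps , closed) s∈ with StepsFrom-split steps s∈
  ... | p , q , refl , steps-p , last-p , steps-q =
    q ++ p , (StepsFrom-++ steps-q last-q steps-p , trans (last-++ q p last-q) last-p)
           , (λ _ → ∈-rotate p q last-q) , (λ _ → ∈-rotate q p last-p)
    where
    last-q = trans (sym (last-++ p q last-p)) closed

  closedWalk-++ : ClosedWalk s xs → ClosedWalk s ys → ClosedWalk s (xs ++ ys)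
  closedWalk-++ {xs = xs} {ys} (steps , closed) (steps' , closed') =
    StepsFrom-++ steps closed steps' , trans (last-++ xs ys closed) closed'

  bud-InC : IsBud C s → s ∈ η → InC[_] C η s
  bud-InC {s} (b , βs≡b) s∈η = s , s∈η , b , βs≡b , proj₁ (β-normal βs≡b) , [] , ++-identityʳ s

  InC-++ˡ : InC[_] C η u → InC[_] C (η ++ η') u
  InC-++ˡ (s , s∈η , s-cycle) = s , ∈-++⁺ˡ s∈η , s-cycle

  InC-++ʳ : InC[_] C η' u → InC[_] C (η ++ η') u
  InC-++ʳ {η = η} (s , s∈η' , s-cycle) = s , ∈-++⁺ʳ η s∈η' , s-cycle

  InC-++⁻ : InC[_] C (η ++ η') u → InC[_] C η u ⊎ InC[_] C η' u
  InC-++⁻ {η} (s , s∈ , s-cycle) with ∈-++⁻ η s∈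
  ... | inj₁ s∈η  = inj₁ (s , s∈η , s-cycle)
  ... | inj₂ s∈η' = inj₂ (s , s∈η' , s-cycle)

  closedWalk-at : StronglyConnected C η → s ∈ η →
                  ∃[ ys ] (ClosedWalk s ys × VisitsExactly η s ys)
  closedWalk-at {s = s} (buds , _ , _ , (_ , steps) , closed , visits) s∈η
    with closedWalk-rotate (steps , closed) (proj₂ (visits s) (bud-InC (All.lookup buds s∈η) s∈η))
  ... | ys , walk , to , from = ys , walk , λ u → proj₁ (visits u) ∘ from u , to u ∘ proj₂ (visits u)

  StronglyConnected-++ : StronglyConnected C η → StronglyConnected C η' → s ∈ η → s ∈ η' →
                         StronglyConnected C (η ++ η')
  StronglyConnected-++ {η} {η'} {s} scη@(buds , _) scη'@(buds' , _) s∈η s∈η'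
    with closedWalk-at scη s∈η | closedWalk-at scη' s∈η'
  ... | xs , walk , visits | ys , walk' , visits' =
    All.++⁺ buds buds' , s , xs ++ ys , (s∈T , proj₁ joined) , proj₂ joined , λ u → to u , from u
    where
    s∈T : s ∈ T
    s∈T = proj₁ (β-leaf (proj₂ (All.lookup buds s∈η)))
    joined = closedWalk-++ walk walk'
    to : ∀ u → u ∈ s ∷ xs ++ ys → InC[_] C (η ++ η') u
    to u = [ InC-++ˡ ∘ proj₁ (visits u) , InC-++ʳ {η = η} ∘ proj₁ (visits' u) ∘ there ]′ ∘ ∈-++⁻ (s ∷ xs)
    from : ∀ u → InC[_] C (η ++ η') u → u ∈ s ∷ xs ++ ys
    from u = [ ∈-++⁺ˡ ∘ proj₂ (visits u) , ∈-∷-++⁺ʳ ∘ proj₂ (visits' u) ]′ ∘ InC-++⁻ {η = η}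

  BMaximal-absorbs : BMaximal C B η → StronglyConnected C (η ++ η') → η' ⊆ₛ B → η' ⊆ₛ η
  BMaximal-absorbs {η = η} {η'} (_ , η⊆B , maximal) sc η'⊆B {t} t∈η' with t ∈? η
  ... | yes t∈η = t∈η
  ... | no  t∉η = ⊥-elim (maximal (η ++ η') sc strict (++-⊆ η⊆B η'⊆B))
    where
    strict : _⊂ₛ_ C η (η ++ η')
    strict = xs⊆xs++ys η η' , λ η++η'⊆η → t∉η (η++η'⊆η (∈-++⁺ʳ η t∈η'))

lemma5p3 : (C : CyclicTree) (B η η' : NodeSet) →
    All (IsBud C) B →
    BMaximal C B η → BMaximal C B η' →
    ((η ⊆ₛ η') × (η' ⊆ₛ η)) ⊎ (∀ s → s ∈ η → s ∈ η' → ⊥)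
lemma5p3 C B η η' _ maxη@(scη , η⊆B , _) maxη'@(scη' , η'⊆B , _) with any? (_∈? η') η
... | no disjoint = inj₂ λ s s∈η s∈η' → disjoint (lose s∈η s∈η')
... | yes common with find common
...   | s , s∈η , s∈η' =
  inj₁ ( BMaximal-absorbs C maxη' (StronglyConnected-++ C scη' scη s∈η' s∈η) η⊆B
       , BMaximal-absorbs C maxη (StronglyConnected-++ C scη scη' s∈η s∈η') η'⊆B )
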